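{- Let $n \geq 6$ be even and let $k = \lfloor \log_2 n \rfloor$. If $n = 2j(k+1) + r$ for nonnegative integers $j, r$ with $4 \leq r < k+1$, then $\gamma(KG_n) > 2j+1 = \left\lceil \frac{n}{\lfloor \log_2 n\rfloor + 1} \right\rceil$.
   Context: For even $n \geq 6$, the Knödel graph $KG_n$ has vertex set $\{0,1,\dots,n-1\}$, and $\{x,y\}$ is an edge if and only if $x + y \equiv 2^t - 1 \pmod n$ for some $t \in \{1,2,\dots,\lfloor \log_2 n\rfloor\}$. A dominating set of a graph $G$ is a set $D$ of vertices such that every vertex is in $D$ or adjacent to a vertex of $D$; $\gamma(G)$ denotes the minimum size of a dominating set. -}

module Defs where

open import Data.Nat using (ℕ; suc; _+_; _*_; _∸_; _^_; _≤_; _<_; NonZero)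
open import Data.Nat.DivMod using (_%_; _/_)
open import Data.Nat.Logarithm using (⌊log₂_⌋)
open import Data.Fin using (Fin; toℕ)
open import Data.List using (List; length)
open import Data.List.Membership.Propositional using (_∈_)
open import Data.Product using (∃-syntax; _×_)
open import Data.Sum using (_⊎_)
open import Relation.Binary.PropositionalEquality using (_≡_)

KGAdj : (n : ℕ) .{{_ : NonZero n}} → Fin n → Fin n → Set
KGAdj n x y =
  ∃[ t ] (1 ≤ t × t ≤ ⌊log₂ n ⌋ × (toℕ x + toℕ y) % n ≡ (2 ^ t ∸ 1) % n)

IsDominatingKG : (n : ℕ) .{{_ : NonZero n}} → List (Fin n) → Set
IsDominatingKG n D = ∀ (v : Fin n) → v ∈ D ⊎ (∃[ u ] (u ∈ D × KGAdj n u v))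

-- γ(KG_n) > m : every dominating set has more than m vertices.
-- (length of a list upper-bounds the size of the set it represents,
--  so this is exactly γ > m.)
DomNumGT : (n : ℕ) .{{_ : NonZero n}} → ℕ → Set
DomNumGT n m = ∀ (D : List (Fin n)) → IsDominatingKG n D → m < length D

⌈_/_⌉ : ℕ → (b : ℕ) .{{_ : NonZero b}} → ℕ
⌈ a / b ⌉ = (a + b ∸ 1) / b

-- Vertices of KG_n of one parity are adjacent only to vertices of the other
-- parity, and a vertex u has at most k = ⌊log₂ n⌋ neighbours, one for each t.
-- So if D dominates and D₀, D₁ are its even and odd parts, each parity class
-- (of size n/2) is covered by one part plus at most k neighbours of each vertex
-- of the other: n/2 ≤ |D₁| + k|D₀| and n/2 ≤ |D₀| + k|D₁|.  If |D| ≤ 2j+1 one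
-- part has at most j vertices, which gives n/2 ≤ j(k+1) + 1, whereas
-- n/2 = j(k+1) + r/2 ≥ j(k+1) + 2.
module Submission where

open import Defs
open import Data.Nat using (ℕ; suc; _+_; _*_; _∸_; _^_; _≤_; _<_; NonZero; z≤n; s≤s; _≟_; _≤?_)
open import Data.Nat.Properties
open import Data.Nat.DivMod
open import Data.Nat.Logarithm using (⌊log₂_⌋)
open import Data.Nat.Divisibility using (_∣_; divides)
open import Data.Nat.Tactic.RingSolver using (solve-∀)
open import Data.Fin using (Fin; toℕ; fromℕ<; join; combine; splitAt)
open import Data.Fin.Properties using (toℕ<n; toℕ-injective; toℕ-fromℕ<; splitAt-join; combine-injective; injective⇒≤)
open import Data.List using (List; []; _∷_; length; filter)
open import Data.List.Relation.Unary.Any using (index)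
open import Data.List.Membership.Propositional using (_∈_)
open import Data.List.Membership.Propositional.Properties using (∈-filter⁺)
open import Data.List.Membership.Setoid.Properties using (index-injective)
open import Data.Product using (_×_; _,_; ∃-syntax)
open import Data.Sum using (_⊎_; inj₁; inj₂; [_,_]′)
open import Data.Sum.Properties using (inj₁-injective; inj₂-injective)
open import Function.Definitions using (Injective)
open import Relation.Nullary using (yes; no; ¬_; contradiction)
open import Level using (0ℓ)
open import Relation.Unary using (Pred; Decidable)
open import Relation.Binary.PropositionalEquality

+-cancelˡ-% : ∀ n .{{_ : NonZero n}} u {v w} → v < n → w < n →
              (u + v) % n ≡ (u + w) % n → v ≡ w
+-cancelˡ-% n u {v} {w} v<n w<n eq = begin
  v                         ≡⟨ m<n⇒m%n≡m v<n ⟨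
  v % n                     ≡⟨ undo-u v ⟩
  (c + (u + v)) % n         ≡⟨ %-distribˡ-+ c (u + v) n ⟩
  (c % n + (u + v) % n) % n ≡⟨ cong (λ x → (c % n + x) % n) eq ⟩
  (c % n + (u + w) % n) % n ≡⟨ %-distribˡ-+ c (u + w) n ⟨
  (c + (u + w)) % n         ≡⟨ undo-u w ⟨
  w % n                     ≡⟨ m<n⇒m%n≡m w<n ⟩
  w                         ∎
  where
  open ≡-Reasoning
  -- c + u ≡ 0 (mod n), so adding c undoes adding u.
  c = n ∸ u % n
  n∣c+u : n ∣ c + u
  n∣c+u = divides (suc (u / n)) (begin
    c + u                   ≡⟨ cong (c +_) (m≡m%n+[m/n]*n u n) ⟩
    c + (u % n + u / n * n) ≡⟨ +-assoc c (u % n) (u / n * n) ⟨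
    c + u % n + u / n * n   ≡⟨ cong (_+ u / n * n) (m∸n+n≡m (m%n≤n u n)) ⟩
    n + u / n * n           ∎)
  undo-u : ∀ x → x % n ≡ (c + (u + x)) % n
  undo-u x = sym (begin
    (c + (u + x)) % n ≡⟨ cong (_% n) (+-assoc c u x) ⟨
    (c + u + x) % n   ≡⟨ %-remove-+ˡ x n∣c+u ⟩
    x % n             ∎)

[2^suc∸1]%2≡1 : ∀ s → (2 ^ suc s ∸ 1) % 2 ≡ 1
[2^suc∸1]%2≡1 s with 2 ^ s | m^n>0 2 s
... | suc m | _ = trans (cong (_% 2) (2*suc∸1 m)) ([m+kn]%n≡m%n 1 m 2)
  where
  2*suc≡2+m*2 : ∀ m → 2 * suc m ≡ 2 + m * 2
  2*suc≡2+m*2 = solve-∀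
  2*suc∸1 : ∀ m → 2 * suc m ∸ 1 ≡ 1 + m * 2
  2*suc∸1 m = cong (_∸ 1) (2*suc≡2+m*2 m)

[x+y]%2≡1⇒x%2+y%2≡1 : ∀ x y → (x + y) % 2 ≡ 1 → x % 2 + y % 2 ≡ 1
[x+y]%2≡1⇒x%2+y%2≡1 x y odd =
  bits (m%n<n x 2) (m%n<n y 2) (trans (sym (%-distribˡ-+ x y 2)) odd)
  where
  bits : ∀ {a b} → a < 2 → b < 2 → (a + b) % 2 ≡ 1 → a + b ≡ 1
  bits {0} {1} _ _ _ = refl
  bits {1} {0} _ _ _ = refl
  bits {0} {0} _ _ ()
  bits {1} {1} _ _ ()
  bits {suc (suc _)} (s≤s (s≤s ())) _ _
  bits {_} {suc (suc _)} _ (s≤s (s≤s ())) _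

module _ {A : Set} {P Q : Pred A 0ℓ} (P? : Decidable P) (Q? : Decidable Q) where

  length-filter-disjoint : (∀ {x} → P x → ¬ Q x) → ∀ xs →
                           length (filter P? xs) + length (filter Q? xs) ≤ length xs
  length-filter-disjoint P⇒¬Q [] = z≤n
  length-filter-disjoint P⇒¬Q (x ∷ xs) with ih ← length-filter-disjoint P⇒¬Q xs | P? x | Q? x
  ... | yes px | yes qx = contradiction qx (P⇒¬Q px)
  ... | yes _  | no _   = s≤s ih
  ... | no _   | yes _  = subst (_≤ suc (length xs)) (sym (+-suc _ _)) (s≤s ih)
  ... | no _   | no _   = m≤n⇒m≤1+n ih

module _ {X : Set} {k : ℕ} (Step : X → Fin k → X → Set) (A B : List X) where

  Covered : X → Set
  Covered x = x ∈ A ⊎ ∃[ b ] ∃[ t ] (b ∈ B × Step b t x)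

  private
    code : ∀ {x} → Covered x → Fin (length A) ⊎ Fin (length B * k)
    code (inj₁ x∈A)               = inj₁ (index x∈A)
    code (inj₂ (_ , t , b∈B , _)) = inj₂ (combine (index b∈B) t)

    code-injective : (∀ b t x y → Step b t x → Step b t y → x ≡ y) →
                     ∀ {x y} (cx : Covered x) (cy : Covered y) → code cx ≡ code cy → x ≡ y
    code-injective _ (inj₁ x∈A) (inj₁ y∈A) eq = index-injective (setoid X) x∈A y∈A (inj₁-injective eq)
    code-injective Step-functional (inj₂ (_ , t , b∈B , sx)) (inj₂ (_ , t′ , b′∈B , sy)) eq
      with index-eq , refl ← combine-injective _ t _ t′ (inj₂-injective eq)
      with refl ← index-injective (setoid X) b∈B b′∈B index-eq
      = Step-functional _ _ _ _ sx sy

    join-injective : ∀ m n → Injective _≡_ _≡_ (join m n)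
    join-injective m n eq = trans (sym (splitAt-join m n _)) (trans (cong (splitAt m) eq) (splitAt-join m n _))

  covered-count : (∀ b t x y → Step b t x → Step b t y → x ≡ y) →
                  ∀ {h} (f : Fin h → X) → Injective _≡_ _≡_ f → (∀ i → Covered (f i)) →
                  h ≤ length A + length B * k
  covered-count Step-functional f f-injective covered =
    injective⇒≤ {f = λ i → join _ _ (code (covered i))} λ {i} {j} eq →
      f-injective (code-injective Step-functional (covered i) (covered j) (join-injective _ _ eq))

≤-split-half : ∀ {x y} j → x + y ≤ 2 * j + 1 → x ≤ j ⊎ y ≤ j
≤-split-half {x} {y} j x+y≤2j+1 with x ≤? j
... | yes x≤j = inj₁ x≤j
... | no  x≰j = inj₂ (+-cancelˡ-≤ (suc j) y j (begin
  suc j + y ≤⟨ +-monoˡ-≤ y (≰⇒> x≰j) ⟩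
  x + y     ≤⟨ x+y≤2j+1 ⟩
  2 * j + 1 ≡⟨ 2j+1≡suc[j]+j j ⟩
  suc j + j ∎))
  where
  open ≤-Reasoning
  2j+1≡suc[j]+j : ∀ j → 2 * j + 1 ≡ suc j + j
  2j+1≡suc[j]+j = solve-∀

small-part-bound : ∀ {x y j k} → 1 ≤ k → x ≤ j → x + y ≤ 2 * j + 1 → y + x * k ≤ j * (k + 1) + 1
small-part-bound {x} {y} {j} {suc k} _ x≤j x+y≤2j+1 = begin
  y + x * suc k       ≡⟨ regroup x y k ⟩
  (x + y) + x * k     ≤⟨ +-mono-≤ x+y≤2j+1 (*-monoˡ-≤ k x≤j) ⟩
  2 * j + 1 + j * k   ≡⟨ collect j k ⟩
  j * (suc k + 1) + 1 ∎
  where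
  open ≤-Reasoning
  regroup : ∀ x y k → y + x * suc k ≡ (x + y) + x * k
  regroup = solve-∀
  collect : ∀ j k → 2 * j + 1 + j * k ≡ j * (suc k + 1) + 1
  collect = solve-∀

half-exceeds : ∀ {h j m r} → h * 2 ≡ 2 * j * m + r → 4 ≤ r → j * m + 1 < h
half-exceeds {h} {j} {m} {r} h*2≡2jm+r 4≤r = *-cancelʳ-≤ (suc (j * m + 1)) h 2 (begin
  suc (j * m + 1) * 2 ≡⟨ expand j m ⟩
  2 * j * m + 4       ≤⟨ +-monoʳ-≤ (2 * j * m) 4≤r ⟩
  2 * j * m + r       ≡⟨ h*2≡2jm+r ⟨
  h * 2               ∎)
  where
  open ≤-Reasoning
  expand : ∀ j m → suc (j * m + 1) * 2 ≡ 2 * j * m + 4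
  expand = solve-∀

⌈q*m+r/m⌉≡suc[q] : ∀ q m .{{_ : NonZero m}} r → 1 ≤ r → r ≤ m → ⌈ q * m + r / m ⌉ ≡ suc q
⌈q*m+r/m⌉≡suc[q] q m@(suc m′) (suc r′) _ r≤m = begin
  (q * m + suc r′ + m ∸ 1) / m ≡⟨ /-congˡ (regroup q m′ r′) ⟩
  (suc q * m + r′) / m         ≡⟨ +-distrib-/-∣ˡ r′ (divides (suc q) refl) ⟩
  suc q * m / m + r′ / m       ≡⟨ cong₂ _+_ (m*n/n≡m (suc q) m) (m<n⇒m/n≡0 r≤m) ⟩
  suc q + 0                    ≡⟨ +-identityʳ (suc q) ⟩
  suc q                        ∎
  where
  open ≡-Reasoning
  regroup : ∀ q m′ r′ → q * suc m′ + suc r′ + suc m′ ∸ 1 ≡ suc q * suc m′ + r′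
  regroup q m′ r′ = trans (cong (_∸ 1) (+-suc (q * suc m′ + suc r′) m′)) (ring q m′ r′)
    where
    ring : ∀ q m′ r′ → q * suc m′ + suc r′ + m′ ≡ suc q * suc m′ + r′
    ring = solve-∀

module _ (n : ℕ) .{{_ : NonZero n}} where

  -- The label t : Fin ⌊log₂ n⌋ stands for the exponent t + 1 ∈ {1, …, ⌊log₂ n⌋}.
  KGStep : Fin n → Fin ⌊log₂ n ⌋ → Fin n → Set
  KGStep u t v = (toℕ u + toℕ v) % n ≡ (2 ^ suc (toℕ t) ∸ 1) % n

  KGStep-functional : ∀ u t v w → KGStep u t v → KGStep u t w → v ≡ w
  KGStep-functional u _ v w u+v u+w =
    toℕ-injective (+-cancelˡ-% n (toℕ u) (toℕ<n v) (toℕ<n w) (trans u+v (sym u+w)))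

  KGAdj⇒KGStep : ∀ {u v} → KGAdj n u v → ∃[ t ] KGStep u t v
  KGAdj⇒KGStep (suc s , _ , s<k , u+v) =
    fromℕ< s<k , subst (λ i → _ ≡ (2 ^ suc i ∸ 1) % n) (sym (toℕ-fromℕ< s<k)) u+v

  KGAdj⇒odd-sum : 2 ∣ n → ∀ {u v} → KGAdj n u v → (toℕ u + toℕ v) % 2 ≡ 1
  KGAdj⇒odd-sum 2∣n {u} {v} (suc s , _ , _ , u+v) = begin
    (toℕ u + toℕ v) % 2     ≡⟨ m∣n⇒o%n%m≡o%m 2 n _ 2∣n ⟨
    (toℕ u + toℕ v) % n % 2 ≡⟨ cong (_% 2) u+v ⟩
    (2 ^ suc s ∸ 1) % n % 2 ≡⟨ m∣n⇒o%n%m≡o%m 2 n _ 2∣n ⟩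
    (2 ^ suc s ∸ 1) % 2     ≡⟨ [2^suc∸1]%2≡1 s ⟩
    1                       ∎
    where open ≡-Reasoning

module _ {n h : ℕ} (n≡h*2 : n ≡ h * 2) {p : ℕ} (p<2 : p < 2) where

  parity-vertex : Fin h → Fin n
  parity-vertex i = fromℕ< (subst (p + toℕ i * 2 <_) (sym n≡h*2)
    (≤-trans (+-monoˡ-≤ (toℕ i * 2) p<2) (*-monoˡ-≤ 2 (toℕ<n i))))

  toℕ-parity-vertex : ∀ i → toℕ (parity-vertex i) ≡ p + toℕ i * 2
  toℕ-parity-vertex i = toℕ-fromℕ< _

  parity-vertex-injective : Injective _≡_ _≡_ parity-vertex
  parity-vertex-injective {i} {j} eq = toℕ-injective (*-cancelʳ-≡ (toℕ i) (toℕ j) 2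
    (+-cancelˡ-≡ p _ _ (trans (sym (toℕ-parity-vertex i)) (trans (cong toℕ eq) (toℕ-parity-vertex j)))))

  parity-vertex-parity : ∀ i → toℕ (parity-vertex i) % 2 ≡ p
  parity-vertex-parity i = begin
    toℕ (parity-vertex i) % 2 ≡⟨ cong (_% 2) (toℕ-parity-vertex i) ⟩
    (p + toℕ i * 2) % 2       ≡⟨ [m+kn]%n≡m%n p (toℕ i) 2 ⟩
    p % 2                     ≡⟨ m<n⇒m%n≡m p<2 ⟩
    p                         ∎
    where open ≡-Reasoning

module _ (n : ℕ) .{{_ : NonZero n}} {h : ℕ} (n≡h*2 : n ≡ h * 2)
         (D : List (Fin n)) (D-dominating : IsDominatingKG n D) where

  D[_] : ℕ → List (Fin n)
  D[ p ] = filter (λ x → toℕ x % 2 ≟ p) D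

  parity-class-bound : ∀ {p q} → p + q ≡ 1 → h ≤ length D[ p ] + length D[ q ] * ⌊log₂ n ⌋
  parity-class-bound {p} {q} p+q≡1 =
    covered-count (KGStep n) D[ p ] D[ q ] (KGStep-functional n)
      (parity-vertex n≡h*2 p<2) (parity-vertex-injective n≡h*2 p<2)
      (λ i → covered _ (parity-vertex-parity n≡h*2 p<2 i))
    where
    p<2 : p < 2
    p<2 = s≤s (subst (p ≤_) p+q≡1 (m≤m+n p q))
    covered : ∀ v → toℕ v % 2 ≡ p → Covered (KGStep n) D[ p ] D[ q ] v
    covered v v%2≡p with D-dominating v
    ... | inj₁ v∈D = inj₁ (∈-filter⁺ _ v∈D v%2≡p)
    ... | inj₂ (u , u∈D , u~v) with t , step ← KGAdj⇒KGStep n {u} {v} u~v =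
      inj₂ (u , t , ∈-filter⁺ _ u∈D u%2≡q , step)
      where
      u%2≡q : toℕ u % 2 ≡ q
      u%2≡q = +-cancelʳ-≡ p (toℕ u % 2) q (begin
        toℕ u % 2 + p         ≡⟨ cong (toℕ u % 2 +_) v%2≡p ⟨
        toℕ u % 2 + toℕ v % 2 ≡⟨ [x+y]%2≡1⇒x%2+y%2≡1 (toℕ u) (toℕ v) (KGAdj⇒odd-sum n (divides h n≡h*2) {u} {v} u~v) ⟩
        1                     ≡⟨ trans (sym p+q≡1) (+-comm p q) ⟩
        q + p                 ∎)
        where open ≡-Reasoning

  dominating-bound : ∀ j → 1 ≤ ⌊log₂ n ⌋ → length D ≤ 2 * j + 1 → h ≤ j * (⌊log₂ n ⌋ + 1) + 1
  dominating-bound j 1≤k |D|≤2j+1 = [ bound-via-odd , bound-via-even ]′ (≤-split-half j |D[0]|+|D[1]|≤2j+1)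
    where
    |D[0]|+|D[1]|≤2j+1 : length D[ 0 ] + length D[ 1 ] ≤ 2 * j + 1
    |D[0]|+|D[1]|≤2j+1 =
      ≤-trans (length-filter-disjoint _ _ (λ x≡0 x≡1 → 0≢1+n (trans (sym x≡0) x≡1)) D) |D|≤2j+1
    bound-via-odd : length D[ 0 ] ≤ j → h ≤ j * (⌊log₂ n ⌋ + 1) + 1
    bound-via-odd |D[0]|≤j = ≤-trans (parity-class-bound {1} {0} refl)
      (small-part-bound 1≤k |D[0]|≤j |D[0]|+|D[1]|≤2j+1)
    bound-via-even : length D[ 1 ] ≤ j → h ≤ j * (⌊log₂ n ⌋ + 1) + 1
    bound-via-even |D[1]|≤j = ≤-trans (parity-class-bound {0} {1} refl)
      (small-part-bound 1≤k |D[1]|≤j (subst (_≤ 2 * j + 1) (+-comm (length D[ 0 ]) _) |D[0]|+|D[1]|≤2j+1))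

corollary14 : (n : ℕ) .{{_ : NonZero n}} → 6 ≤ n → 2 ∣ n →
    (j r : ℕ) → n ≡ 2 * j * (⌊log₂ n ⌋ + 1) + r → 4 ≤ r → r < ⌊log₂ n ⌋ + 1 →
    DomNumGT n (2 * j + 1) × 2 * j + 1 ≡ ⌈ n / suc ⌊log₂ n ⌋ ⌉
corollary14 n _ (divides h n≡h*2) j r n≡2j[k+1]+r 4≤r r<k+1 = γ>2j+1 , ceiling
  where
  k = ⌊log₂ n ⌋
  1≤r : 1 ≤ r
  1≤r = ≤-trans (s≤s z≤n) 4≤r
  1≤k : 1 ≤ k
  1≤k = +-cancelʳ-≤ 1 1 k (≤-trans (s≤s 1≤r) r<k+1)
  γ>2j+1 : DomNumGT n (2 * j + 1)
  γ>2j+1 D D-dominating = ≰⇒> λ |D|≤2j+1 → <⇒≱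
    (half-exceeds {h} {j} (trans (sym n≡h*2) n≡2j[k+1]+r) 4≤r)
    (dominating-bound n n≡h*2 D D-dominating j 1≤k |D|≤2j+1)
  ceiling : 2 * j + 1 ≡ ⌈ n / suc k ⌉
  ceiling = begin
    2 * j + 1                      ≡⟨ +-comm (2 * j) 1 ⟩
    suc (2 * j)                    ≡⟨ ⌈q*m+r/m⌉≡suc[q] (2 * j) (suc k) r 1≤r r≤suc[k] ⟨
    ⌈ 2 * j * suc k + r / suc k ⌉  ≡⟨ cong (λ x → ⌈ x / suc k ⌉) n≡2j[suc[k]]+r ⟨
    ⌈ n / suc k ⌉                  ∎
    where
    open ≡-Reasoning
    r≤suc[k] : r ≤ suc k
    r≤suc[k] = <⇒≤ (subst (r <_) (+-comm k 1) r<k+1)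
    n≡2j[suc[k]]+r : n ≡ 2 * j * suc k + r
    n≡2j[suc[k]]+r = trans n≡2j[k+1]+r (cong (λ m → 2 * j * m + r) (+-comm k 1))
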